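{- Let $n\geq 2$. The partition lattice $\Pi_n$ is strongly coset-like if and only if $n\leq 4$.
   Context: $\Pi_n$ is the lattice of all set partitions of $\{1,\ldots,n\}$ ordered by refinement (the partition into singletons is the bottom, the one-block partition is the top). For a finite lattice $L$ with distinct bottom $\widehat 0$ and top $\widehat 1$, let $J$ be its set of join-irreducible elements (elements $x\neq\widehat 0$ such that $x=a\vee b$ implies $a=x$ or $b=x$) and $J_x=\{j\in J:j\leq x\}$. $L$ is strongly coset-like if $|J_x|$ divides $|J|$ for every $x\in L\setminus\{\widehat 0\}$. -}

module Defs where

open import Data.Bool using (Bool; T)
open import Data.Nat using (ℕ)
open import Data.Fin using (Fin; _≟_)
open import Data.Vec using (Vec; lookup; tabulate)
open import Data.List using (List; length)
open import Data.List.Membership.Propositional using (_∈_)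
open import Data.List.Relation.Unary.Unique.Propositional using (Unique)
open import Data.Product using (Σ; _×_; ∃-syntax)
open import Data.Sum using (_⊎_)
open import Data.Nat.Divisibility using (_∣_)
open import Function.Bundles using (_⇔_)
open import Relation.Binary.PropositionalEquality using (_≡_; _≢_)
open import Relation.Nullary.Decidable using (⌊_⌋)

-- A binary relation on {0,…,n-1}, stored as a Boolean n×n matrix
-- (so that equal relations are propositionally equal).
BRel : ℕ → Set
BRel n = Vec (Vec Bool n) n

_∼[_]_ : {n : ℕ} → Fin n → BRel n → Fin n → Set
i ∼[ R ] j = T (lookup (lookup R i) j)

-- A set partition of {0,…,n-1} is represented by its equivalence relation
-- "lie in the same block".
record IsPartition {n : ℕ} (R : BRel n) : Set where
  field
    reflexive  : ∀ i → i ∼[ R ] i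
    symmetric  : ∀ i j → i ∼[ R ] j → j ∼[ R ] i
    transitive : ∀ i j k → i ∼[ R ] j → j ∼[ R ] k → i ∼[ R ] k

_≤Π_ : {n : ℕ} → BRel n → BRel n → Set
x ≤Π y = ∀ i j → i ∼[ x ] j → i ∼[ y ] j

bottom : (n : ℕ) → BRel n
bottom n = tabulate (λ i → tabulate (λ j → ⌊ i ≟ j ⌋))

IsJoin : {n : ℕ} → BRel n → BRel n → BRel n → Set
IsJoin {n} a b x =
  a ≤Π x × b ≤Π x × (∀ z → IsPartition z → a ≤Π z → b ≤Π z → x ≤Π z)

JoinIrreducible : {n : ℕ} → BRel n → Set
JoinIrreducible {n} x =
  IsPartition x × x ≢ bottom n ×
  (∀ a b → IsPartition a → IsPartition b → IsJoin a b x → a ≡ x ⊎ b ≡ x)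

JoinIrreducibleBelow : {n : ℕ} → BRel n → BRel n → Set
JoinIrreducibleBelow x j = JoinIrreducible j × j ≤Π x

HasSize : {n : ℕ} → (BRel n → Set) → ℕ → Set
HasSize {n} P k =
  Σ (List (BRel n)) λ l → length l ≡ k × Unique l × (∀ R → (R ∈ l) ⇔ P R)

StronglyCosetLike : ℕ → Set
StronglyCosetLike n =
  ∀ (x : BRel n) → IsPartition x → x ≢ bottom n →
  ∃[ a ] ∃[ b ] (HasSize (JoinIrreducibleBelow x) a × HasSize (JoinIrreducible {n}) b × a ∣ b)

{-# OPTIONS --safe #-}
module Submission where

-- The join-irreducible partitions are the atoms, whose only non-singleton block is a pair {i, j}:
-- a partition relating i ≠ j is the join of the atom {i, j} with the partition splitting i off its
-- block. Hence |J| = C(n, 2) and |J_x| is the number of pairs i < j in a common block of x.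
-- For n = m + 1 ≥ 5 the partition {0} | {1, …, m} has |J_x| = C(m, 2) and |J| = C(m, 2) + m, and
-- C(m, 2) ∤ m since C(m, 2) > m. For n ≤ 4, labelling each point by the first point of its block
-- makes x the kernel of a map Fin n → Fin n, and all n^n such maps are checked by evaluation.

open import Defs
open import Data.Bool using (Bool; true; false; T; if_then_else_)
open import Data.Bool.Properties using (T?)
open import Data.Empty using (⊥-elim)
open import Data.Fin using (Fin; zero; suc; _≟_; _<_)
open import Data.Fin.Properties using (all?; any?; suc-injective; <⇒≢; <-asym)
open import Data.List using (List; []; _∷_; _++_; map; filter; length)
  renaming (tabulate to listTabulate)
open import Data.List.Properties
  using (length-++; length-map; length-tabulate; ++-identityʳ; filter-++; filter-all; filter-none; filter-≐)
open import Data.List.Membership.Propositional using (_∈_)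
open import Data.List.Membership.Propositional.Properties
  using (∈-map⁻; ∈-map⁺; ∈-++⁻; ∈-++⁺ˡ; ∈-++⁺ʳ; ∈-tabulate⁻; ∈-tabulate⁺; ∈-filter⁻; ∈-filter⁺; ∈-length)
open import Data.List.Membership.Propositional.Properties.WithK using (unique∧set⇒bag)
open import Data.List.Relation.Binary.BagAndSetEquality using (∼bag⇒↭)
open import Data.List.Relation.Binary.Permutation.Propositional.Properties using (↭-length)
open import Data.List.Relation.Unary.All as All using (All)
import Data.List.Relation.Unary.All.Properties as All
open import Data.List.Relation.Unary.Any using (here; there)
open import Data.List.Relation.Unary.Unique.Propositional using (Unique; []; _∷_)
import Data.List.Relation.Unary.Unique.Propositional.Properties as Unique
open import Data.Maybe using (Maybe; just; nothing)
import Data.Maybe as Maybe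
open import Data.Maybe.Properties using (just-injective)
open import Data.Nat using (ℕ; zero; suc; _+_; _≤_; z≤n; s≤s; _<?_)
  renaming (_<_ to _<ℕ_)
open import Data.Nat.Divisibility using (_∣_; _∣?_; ∣⇒≤; ∣m+n∣m⇒∣n; ∣-refl)
open import Data.Nat.Properties using (+-comm; +-mono-≤; <⇒≱; ≮⇒≥; m≤n⇒∃[o]m+o≡n)
open import Data.Product using (_×_; _,_; proj₁; proj₂; ∃-syntax; uncurry)
open import Data.Sum using (_⊎_; inj₁; inj₂)
open import Data.Unit using (⊤; tt)
open import Data.Vec using (Vec; []; _∷_; lookup; tabulate)
open import Data.Vec.Properties using (lookup∘tabulate; tabulate∘lookup; tabulate-cong)
open import Function using (_∘_)
open import Function.Bundles using (_⇔_; mk⇔; Equivalence)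
import Function.Properties.Equivalence as ⇔
open import Relation.Binary.PropositionalEquality
open import Relation.Nullary using (¬_; Dec; yes; no; ¬?)
open import Relation.Nullary.Decidable
  using (⌊_⌋; toWitness; fromWitness; map′; _×-dec_; _⊎-dec_; _→-dec_)
open import Relation.Unary using (Pred; Decidable)
open import Level using (0ℓ)

open Equivalence using (to; from)

private
  variable
    n : ℕ
    i j p q : Fin n

entry : BRel n → Fin n → Fin n → Bool
entry R i j = lookup (lookup R i) j

T-ext : {a b : Bool} → (T a → T b) → (T b → T a) → a ≡ b
T-ext {false} {false} _ _ = refl
T-ext {false} {true}  _ g = ⊥-elim (g tt)
T-ext {true}  {false} f _ = ⊥-elim (f tt)
T-ext {true}  {true}  _ _ = refl

tabulate∘entry : (R : BRel n) → tabulate (λ i → tabulate (entry R i)) ≡ R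
tabulate∘entry R = trans (tabulate-cong (λ i → tabulate∘lookup (lookup R i))) (tabulate∘lookup R)

≤Π-antisym : {R S : BRel n} → R ≤Π S → S ≤Π R → R ≡ S
≤Π-antisym {R = R} {S} R≤S S≤R = begin
  R                                       ≡⟨ tabulate∘entry R ⟨
  tabulate (λ i → tabulate (entry R i))   ≡⟨ tabulate-cong (λ i → tabulate-cong (λ j → T-ext (R≤S i j) (S≤R i j))) ⟩
  tabulate (λ i → tabulate (entry S i))   ≡⟨ tabulate∘entry S ⟩
  S                                       ∎
  where open ≡-Reasoning

fromDecidable : {P : Fin n → Fin n → Set} → (∀ i j → Dec (P i j)) → BRel n
fromDecidable P? = tabulate (λ i → tabulate (λ j → ⌊ P? i j ⌋))

∼-fromDecidable : {P : Fin n → Fin n → Set} (P? : ∀ i j → Dec (P i j)) (i j : Fin n) →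
                  i ∼[ fromDecidable P? ] j ⇔ P i j
∼-fromDecidable P? i j =
  mk⇔ (toWitness ∘ subst T entry-eq) (subst T (sym entry-eq) ∘ fromWitness)
  where
  entry-eq : entry (fromDecidable P?) i j ≡ ⌊ P? i j ⌋
  entry-eq rewrite lookup∘tabulate (λ i → tabulate (λ j → ⌊ P? i j ⌋)) i =
    lookup∘tabulate (λ j → ⌊ P? i j ⌋) j

∼-bottom : (i j : Fin n) → i ∼[ bottom n ] j ⇔ i ≡ j
∼-bottom = ∼-fromDecidable _≟_

bottom-isPartition : IsPartition (bottom n)
bottom-isPartition = record
  { reflexive  = λ i → from (∼-bottom i i) refl
  ; symmetric  = λ i j i∼j → from (∼-bottom j i) (sym (to (∼-bottom i j) i∼j))
  ; transitive = λ i j k i∼j j∼k →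
      from (∼-bottom i k) (trans (to (∼-bottom i j) i∼j) (to (∼-bottom j k) j∼k))
  }

trivial? : (i j : Fin n) → Dec ⊤
trivial? _ _ = yes tt

top : (n : ℕ) → BRel n
top n = fromDecidable (trivial? {n})

∼-top : (i j : Fin n) → i ∼[ top n ] j
∼-top i j = from (∼-fromDecidable trivial? i j) tt

top-isPartition : IsPartition (top n)
top-isPartition = record
  { reflexive = λ i → ∼-top i i ; symmetric = λ i j _ → ∼-top j i ; transitive = λ i _ k _ _ → ∼-top i k }

-- Join-irreducible partitions are atoms

Endpoint : Fin n → Fin n → Fin n → Set
Endpoint i j p = p ≡ i ⊎ p ≡ j

AtomRel : Fin n → Fin n → Fin n → Fin n → Set
AtomRel i j p q = p ≡ q ⊎ (Endpoint i j p × Endpoint i j q)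

endpoint? : (i j p : Fin n) → Dec (Endpoint i j p)
endpoint? i j p = p ≟ i ⊎-dec p ≟ j

atomRel? : (i j p q : Fin n) → Dec (AtomRel i j p q)
atomRel? i j p q = p ≟ q ⊎-dec (endpoint? i j p ×-dec endpoint? i j q)

atom : Fin n → Fin n → BRel n
atom i j = fromDecidable (atomRel? i j)

∼-atom : (i j p q : Fin n) → p ∼[ atom i j ] q ⇔ AtomRel i j p q
∼-atom i j = ∼-fromDecidable (atomRel? i j)

∼-atom-ends : (i j : Fin n) → i ∼[ atom i j ] j
∼-atom-ends i j = from (∼-atom i j i j) (inj₂ (inj₁ refl , inj₂ refl))

Endpoint-swap : Endpoint i j p → Endpoint j i p
Endpoint-swap (inj₁ p≡i) = inj₂ p≡i
Endpoint-swap (inj₂ p≡j) = inj₁ p≡j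

atom-comm : (i j : Fin n) → atom i j ≡ atom j i
atom-comm i j = ≤Π-antisym swap swap
  where
  swap : ∀ {i j : Fin _} → atom i j ≤Π atom j i
  swap {i} {j} p q p∼q with to (∼-atom i j p q) p∼q
  ... | inj₁ p≡q            = from (∼-atom j i p q) (inj₁ p≡q)
  ... | inj₂ (end-p , end-q) = from (∼-atom j i p q) (inj₂ (Endpoint-swap end-p , Endpoint-swap end-q))

atom-isPartition : (i j : Fin n) → IsPartition (atom i j)
atom-isPartition i j = record
  { reflexive  = λ p → from (∼-atom i j p p) (inj₁ refl)
  ; symmetric  = λ p q p∼q → from (∼-atom i j q p) (symmetric (to (∼-atom i j p q) p∼q))
  ; transitive = λ p q r p∼q q∼r →
      from (∼-atom i j p r) (transitive (to (∼-atom i j p q) p∼q) (to (∼-atom i j q r) q∼r))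
  }
  where
  symmetric : ∀ {p q} → AtomRel i j p q → AtomRel i j q p
  symmetric (inj₁ p≡q)            = inj₁ (sym p≡q)
  symmetric (inj₂ (end-p , end-q)) = inj₂ (end-q , end-p)
  transitive : ∀ {p q r} → AtomRel i j p q → AtomRel i j q r → AtomRel i j p r
  transitive (inj₁ refl)           q∼r                   = q∼r
  transitive (inj₂ p∼q)            (inj₁ refl)           = inj₂ p∼q
  transitive (inj₂ (end-p , _))    (inj₂ (_ , end-r))    = inj₂ (end-p , end-r)

atom-least : {R : BRel n} → IsPartition R → i ∼[ R ] j → atom i j ≤Π R
atom-least {i = i} {j} PR i∼j p q p∼q with to (∼-atom i j p q) p∼q
... | inj₁ refl                    = IsPartition.reflexive PR p
... | inj₂ (inj₁ refl , inj₁ refl) = IsPartition.reflexive PR p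
... | inj₂ (inj₁ refl , inj₂ refl) = i∼j
... | inj₂ (inj₂ refl , inj₁ refl) = IsPartition.symmetric PR i j i∼j
... | inj₂ (inj₂ refl , inj₂ refl) = IsPartition.reflexive PR p

below-atom-without-ends : {a : BRel n} → IsPartition a → a ≤Π atom i j →
                          ¬ i ∼[ a ] j → a ≤Π bottom n
below-atom-without-ends {i = i} {j} Pa a≤atom i≁j p q p∼q with to (∼-atom i j p q) (a≤atom p q p∼q)
... | inj₁ p≡q                     = from (∼-bottom p q) p≡q
... | inj₂ (inj₁ refl , inj₁ refl) = from (∼-bottom p p) refl
... | inj₂ (inj₁ refl , inj₂ refl) = ⊥-elim (i≁j p∼q)
... | inj₂ (inj₂ refl , inj₁ refl) = ⊥-elim (i≁j (IsPartition.symmetric Pa p q p∼q))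
... | inj₂ (inj₂ refl , inj₂ refl) = from (∼-bottom p p) refl

atom-isJoinIrreducible : i ≢ j → JoinIrreducible (atom i j)
atom-isJoinIrreducible {i = i} {j = j} i≢j = atom-isPartition i j , atom≢bottom , irreducible
  where
  atom≢bottom : atom i j ≢ bottom _
  atom≢bottom atom≡bottom = i≢j (to (∼-bottom i j) (subst (i ∼[_] j) atom≡bottom (∼-atom-ends i j)))
  irreducible : ∀ a b → IsPartition a → IsPartition b → IsJoin a b (atom i j) →
                a ≡ atom i j ⊎ b ≡ atom i j
  irreducible a b Pa Pb (a≤ , b≤ , least) with T? (entry a i j) | T? (entry b i j)
  ... | yes i∼ₐj | _       = inj₁ (≤Π-antisym a≤ (atom-least Pa i∼ₐj))
  ... | no _     | yes i∼ᵦj = inj₂ (≤Π-antisym b≤ (atom-least Pb i∼ᵦj))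
  ... | no i≁ₐj  | no i≁ᵦj  = ⊥-elim (atom≢bottom (≤Π-antisym
    (least (bottom _) bottom-isPartition
      (below-atom-without-ends Pa a≤ i≁ₐj) (below-atom-without-ends Pb b≤ i≁ᵦj))
    (λ p q p∼q → from (∼-atom i j p q) (inj₁ (to (∼-bottom p q) p∼q)))))

IsolateRel : BRel n → Fin n → Fin n → Fin n → Set
IsolateRel R i p q = p ≡ q ⊎ (p ≢ i × q ≢ i × p ∼[ R ] q)

isolateRel? : (R : BRel n) (i p q : Fin n) → Dec (IsolateRel R i p q)
isolateRel? R i p q = p ≟ q ⊎-dec (¬? (p ≟ i) ×-dec ¬? (q ≟ i) ×-dec T? (entry R p q))

isolate : BRel n → Fin n → BRel n
isolate R i = fromDecidable (isolateRel? R i)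

∼-isolate : (R : BRel n) (i p q : Fin n) → p ∼[ isolate R i ] q ⇔ IsolateRel R i p q
∼-isolate R i = ∼-fromDecidable (isolateRel? R i)

isolate-isPartition : {R : BRel n} → IsPartition R → (i : Fin n) → IsPartition (isolate R i)
isolate-isPartition {R = R} PR i = record
  { reflexive  = λ p → from (∼-isolate R i p p) (inj₁ refl)
  ; symmetric  = λ p q p∼q → from (∼-isolate R i q p) (sym′ (to (∼-isolate R i p q) p∼q))
  ; transitive = λ p q r p∼q q∼r →
      from (∼-isolate R i p r) (trans′ (to (∼-isolate R i p q) p∼q) (to (∼-isolate R i q r) q∼r))
  }
  where
  open IsPartition PR
  sym′ : ∀ {p q} → IsolateRel R i p q → IsolateRel R i q p
  sym′ (inj₁ p≡q)              = inj₁ (sym p≡q)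
  sym′ (inj₂ (p≢i , q≢i , p∼q)) = inj₂ (q≢i , p≢i , symmetric _ _ p∼q)
  trans′ : ∀ {p q r} → IsolateRel R i p q → IsolateRel R i q r → IsolateRel R i p r
  trans′ (inj₁ refl)               q∼r                       = q∼r
  trans′ (inj₂ p∼q)                (inj₁ refl)               = inj₂ p∼q
  trans′ (inj₂ (p≢i , _ , p∼q))    (inj₂ (_ , r≢i , q∼r))    =
    inj₂ (p≢i , r≢i , transitive _ _ _ p∼q q∼r)

isolate-≤ : {R : BRel n} → IsPartition R → (i : Fin n) → isolate R i ≤Π R
isolate-≤ {R = R} PR i p q p∼q with to (∼-isolate R i p q) p∼q
... | inj₁ refl           = IsPartition.reflexive PR p
... | inj₂ (_ , _ , p∼q′) = p∼q′

-- Every other element p of the block of i is joined to i through j: p ∼ j in isolate R i.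
atom∨isolate : {R : BRel n} → IsPartition R → i ≢ j → i ∼[ R ] j → IsJoin (atom i j) (isolate R i) R
atom∨isolate {i = i} {j} {R} PR i≢j i∼j = atom-least PR i∼j , isolate-≤ PR i , least
  where
  open IsPartition PR
  least : ∀ z → IsPartition z → atom i j ≤Π z → isolate R i ≤Π z → R ≤Π z
  least z Pz atom≤z isolate≤z = R≤z
    where
    module Z = IsPartition Pz
    j∼i : j ∼[ z ] i
    j∼i = Z.symmetric i j (atom≤z i j (∼-atom-ends i j))
    toward-i : ∀ p → p ≢ i → p ∼[ R ] i → p ∼[ z ] i
    toward-i p p≢i p∼i with p ≟ j
    ... | yes refl = j∼i
    ... | no p≢j   = Z.transitive p j i
      (isolate≤z p j (from (∼-isolate R i p j) (inj₂ (p≢i , i≢j ∘ sym , transitive p i j p∼i i∼j)))) j∼i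
    R≤z : R ≤Π z
    R≤z p q p∼q with p ≟ i | q ≟ i
    ... | yes refl | yes refl = Z.reflexive p
    ... | yes refl | no q≢i   = Z.symmetric q p (toward-i q q≢i (symmetric p q p∼q))
    ... | no p≢i   | yes refl = toward-i p p≢i p∼q
    ... | no p≢i   | no q≢i   = isolate≤z p q (from (∼-isolate R i p q) (inj₂ (p≢i , q≢i , p∼q)))

nontrivial-pair : {R : BRel n} → IsPartition R → R ≢ bottom n → ∃[ i ] ∃[ j ] i ≢ j × i ∼[ R ] j
nontrivial-pair {R = R} PR R≢bottom with any? (λ i → any? (λ j → ¬? (i ≟ j) ×-dec T? (entry R i j)))
... | yes pair = pair
... | no none  = ⊥-elim (R≢bottom (≤Π-antisym R≤bottom bottom≤R))
  where
  R≤bottom : R ≤Π bottom _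
  R≤bottom p q p∼q with p ≟ q
  ... | yes p≡q = from (∼-bottom p q) p≡q
  ... | no p≢q  = ⊥-elim (none (p , q , p≢q , p∼q))
  bottom≤R : bottom _ ≤Π R
  bottom≤R p q p∼q with to (∼-bottom p q) p∼q
  ... | refl = IsPartition.reflexive PR p

joinIrreducible⇒atom : {R : BRel n} → JoinIrreducible R → ∃[ i ] ∃[ j ] i ≢ j × R ≡ atom i j
joinIrreducible⇒atom {R = R} (PR , R≢bottom , irreducible) with nontrivial-pair PR R≢bottom
... | i , j , i≢j , i∼j with irreducible _ _ (atom-isPartition i j) (isolate-isPartition PR i)
                                          (atom∨isolate PR i≢j i∼j)
...   | inj₁ atom≡R    = i , j , i≢j , sym atom≡R
...   | inj₂ isolate≡R with to (∼-isolate R i i j) (subst (i ∼[_] j) (sym isolate≡R) i∼j)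
...     | inj₁ i≡j            = ⊥-elim (i≢j i≡j)
...     | inj₂ (i≢i , _ , _)  = ⊥-elim (i≢i refl)

-- Counting join-irreducibles

shift : Fin n × Fin n → Fin (suc n) × Fin (suc n)
shift (i , j) = suc i , suc j

pairsFromZero : (n : ℕ) → List (Fin (suc n) × Fin (suc n))
pairsFromZero n = listTabulate (λ j → zero , suc j)

pairs : (n : ℕ) → List (Fin n × Fin n)
pairs zero    = []
pairs (suc n) = map shift (pairs n) ++ pairsFromZero n

length-pairs : (n : ℕ) → length (pairs (suc n)) ≡ length (pairs n) + n
length-pairs n = begin
  length (map shift (pairs n) ++ pairsFromZero n)
    ≡⟨ length-++ (map shift (pairs n)) ⟩
  length (map shift (pairs n)) + length (pairsFromZero n)
    ≡⟨ cong₂ _+_ (length-map shift (pairs n)) (length-tabulate _) ⟩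
  length (pairs n) + n
    ∎
  where open ≡-Reasoning

∈-pairs⇒< : {ij : Fin n × Fin n} → ij ∈ pairs n → proj₁ ij < proj₂ ij
∈-pairs⇒< {n = suc n} ij∈ with ∈-++⁻ (map shift (pairs n)) ij∈
... | inj₁ ∈shifted with ∈-map⁻ shift ∈shifted
...   | _ , ij∈′ , refl = s≤s (∈-pairs⇒< ij∈′)
∈-pairs⇒< {n = suc n} ij∈ | inj₂ ∈first with ∈-tabulate⁻ ∈first
...   | _ , refl = s≤s z≤n

pairs-unique : (n : ℕ) → Unique (pairs n)
pairs-unique zero    = []
pairs-unique (suc n) = Unique.++⁺
  (Unique.map⁺ shift-injective (pairs-unique n))
  (Unique.tabulate⁺ (suc-injective ∘ cong proj₂))
  disjoint
  where
  shift-injective : ∀ {ij kl : Fin n × Fin n} → shift ij ≡ shift kl → ij ≡ kl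
  shift-injective {_ , _} {_ , _} refl = refl
  disjoint : ∀ {ij} → ¬ (ij ∈ map shift (pairs n) × ij ∈ pairsFromZero n)
  disjoint (∈shifted , ∈first) with ∈-map⁻ shift ∈shifted | ∈-tabulate⁻ ∈first
  ... | _ , _ , refl | _ , ()

pairs-complete : (i j : Fin n) → i ≢ j → (i , j) ∈ pairs n ⊎ (j , i) ∈ pairs n
pairs-complete {suc n} zero    zero    0≢0 = ⊥-elim (0≢0 refl)
pairs-complete {suc n} zero    (suc j) _   = inj₁ (∈-++⁺ʳ (map shift (pairs n)) (∈-tabulate⁺ j))
pairs-complete {suc n} (suc i) zero    _   = inj₂ (∈-++⁺ʳ (map shift (pairs n)) (∈-tabulate⁺ i))
pairs-complete {suc n} (suc i) (suc j) i≢j with pairs-complete i j (i≢j ∘ cong suc)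
... | inj₁ ij∈ = inj₁ (∈-++⁺ˡ (∈-map⁺ shift ij∈))
... | inj₂ ji∈ = inj₂ (∈-++⁺ˡ (∈-map⁺ shift ji∈))

atomOf : Fin n × Fin n → BRel n
atomOf = uncurry atom

atomOf-injectiveOn-pairs : {ij kl : Fin n × Fin n} → ij ∈ pairs n → kl ∈ pairs n →
                           atomOf ij ≡ atomOf kl → ij ≡ kl
atomOf-injectiveOn-pairs {ij = i , j} {k , l} ij∈ kl∈ atoms≡
  with to (∼-atom k l i j) (subst (i ∼[_] j) atoms≡ (∼-atom-ends i j))
... | inj₁ i≡j                     = ⊥-elim (<⇒≢ (∈-pairs⇒< ij∈) i≡j)
... | inj₂ (inj₁ refl , inj₁ refl) = ⊥-elim (<⇒≢ (∈-pairs⇒< ij∈) refl)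
... | inj₂ (inj₁ refl , inj₂ refl) = refl
... | inj₂ (inj₂ refl , inj₁ refl) = ⊥-elim (<-asym (∈-pairs⇒< ij∈) (∈-pairs⇒< kl∈))
... | inj₂ (inj₂ refl , inj₂ refl) = ⊥-elim (<⇒≢ (∈-pairs⇒< ij∈) refl)

Unique-map⁺-injectiveOn : {A B : Set} {f : A → B} {xs : List A} →
                          (∀ {x y} → x ∈ xs → y ∈ xs → f x ≡ f y → x ≡ y) →
                          Unique xs → Unique (map f xs)
Unique-map⁺-injectiveOn inj [] = []
Unique-map⁺-injectiveOn {f = f} inj (x∉xs ∷ xs-unique) =
  All.map⁺ (All.tabulate (λ y∈xs fx≡fy → All.lookup x∉xs y∈xs (inj (here refl) (there y∈xs) fx≡fy)))
  ∷ Unique-map⁺-injectiveOn (λ x∈ y∈ → inj (there x∈) (there y∈)) xs-unique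

Related : BRel n → Pred (Fin n × Fin n) _
Related x = uncurry (_∼[ x ]_)

related? : (x : BRel n) → Decidable (Related x)
related? x (i , j) = T? (entry x i j)

relatedPairs : BRel n → List (Fin n × Fin n)
relatedPairs x = filter (related? x) (pairs _)

∈-relatedPairs⁻ : (x : BRel n) {ij : Fin n × Fin n} → ij ∈ relatedPairs x → ij ∈ pairs n × Related x ij
∈-relatedPairs⁻ x = ∈-filter⁻ (related? x) {xs = pairs _}

relatedPairs-complete : {x : BRel n} → IsPartition x → i ≢ j → i ∼[ x ] j →
                        ∃[ ij ] ij ∈ relatedPairs x × atom i j ≡ atomOf ij
relatedPairs-complete {i = i} {j} {x} Px i≢j i∼j with pairs-complete i j i≢j
... | inj₁ ij∈ = (i , j) , ∈-filter⁺ (related? x) ij∈ i∼j , refl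
... | inj₂ ji∈ = (j , i) , ∈-filter⁺ (related? x) ji∈ (IsPartition.symmetric Px i j i∼j) , atom-comm i j

hasSize-unique : {P : BRel n → Set} {a b : ℕ} → HasSize P a → HasSize P b → a ≡ b
hasSize-unique (l₁ , refl , l₁-unique , ∈l₁⇔P) (l₂ , refl , l₂-unique , ∈l₂⇔P) =
  ↭-length (∼bag⇒↭ (unique∧set⇒bag l₁-unique l₂-unique
    (λ {R} → ⇔.trans (∈l₁⇔P R) (⇔.sym (∈l₂⇔P R)))))

hasSize-resp-⇔ : {P Q : BRel n → Set} {k : ℕ} → (∀ R → P R ⇔ Q R) → HasSize P k → HasSize Q k
hasSize-resp-⇔ P⇔Q (l , len , l-unique , ∈l⇔P) = l , len , l-unique , λ R → ⇔.trans (∈l⇔P R) (P⇔Q R)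

hasSize-joinIrreducibleBelow : {x : BRel n} → IsPartition x →
                               HasSize (JoinIrreducibleBelow x) (length (relatedPairs x))
hasSize-joinIrreducibleBelow {x = x} Px =
  map atomOf (relatedPairs x) ,
  length-map atomOf (relatedPairs x) ,
  Unique-map⁺-injectiveOn
    (λ ij∈ kl∈ → atomOf-injectiveOn-pairs (proj₁ (∈-relatedPairs⁻ x ij∈)) (proj₁ (∈-relatedPairs⁻ x kl∈)))
    (Unique.filter⁺ (related? x) (pairs-unique _)) ,
  λ R → mk⇔ (sound R) (complete R)
  where
  sound : ∀ R → R ∈ map atomOf (relatedPairs x) → JoinIrreducibleBelow x R
  sound R R∈ with ∈-map⁻ atomOf R∈
  ... | (i , j) , ij∈ , refl with ∈-relatedPairs⁻ x ij∈
  ...   | ij∈pairs , i∼j = atom-isJoinIrreducible (<⇒≢ (∈-pairs⇒< ij∈pairs)) , atom-least Px i∼j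
  complete : ∀ R → JoinIrreducibleBelow x R → R ∈ map atomOf (relatedPairs x)
  complete R (R-irreducible , R≤x) with joinIrreducible⇒atom R-irreducible
  ... | i , j , i≢j , refl with relatedPairs-complete Px i≢j (R≤x i j (∼-atom-ends i j))
  ...   | ij , ij∈ , atom≡ = subst (_∈ map atomOf (relatedPairs x)) (sym atom≡) (∈-map⁺ atomOf ij∈)

hasSize-joinIrreducible : (n : ℕ) → HasSize (JoinIrreducible {n}) (length (pairs n))
hasSize-joinIrreducible n = subst (HasSize JoinIrreducible) (cong length relatedPairs-top)
  (hasSize-resp-⇔ (λ R → mk⇔ proj₁ (λ R-irreducible → R-irreducible , λ i j _ → ∼-top i j))
    (hasSize-joinIrreducibleBelow top-isPartition))
  where
  relatedPairs-top : relatedPairs (top n) ≡ pairs n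
  relatedPairs-top = filter-all (related? (top n)) (All.universal (uncurry ∼-top) (pairs n))

0<length-relatedPairs : {x : BRel n} → IsPartition x → x ≢ bottom n → 0 <ℕ length (relatedPairs x)
0<length-relatedPairs Px x≢bottom with nontrivial-pair Px x≢bottom
... | i , j , i≢j , i∼j = ∈-length (proj₁ (proj₂ (relatedPairs-complete Px i≢j i∼j)))

-- n ≤ 4

firstTrue : (Fin n → Bool) → Maybe (Fin n)
firstTrue {zero}  b = nothing
firstTrue {suc n} b = if b zero then just zero else Maybe.map suc (firstTrue (b ∘ suc))

firstTrue-cong : {b c : Fin n → Bool} → b ≗ c → firstTrue b ≡ firstTrue c
firstTrue-cong {zero}  _   = refl
firstTrue-cong {suc n} b≗c rewrite b≗c zero | firstTrue-cong (b≗c ∘ suc) = refl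

firstTrue-just : (b : Fin n → Bool) → T (b i) → ∃[ j ] firstTrue b ≡ just j × T (b j)
firstTrue-just {suc n} {i} b bᵢ with b zero in b₀
... | true  = zero , refl , subst T (sym b₀) tt
... | false with i
...   | zero  = ⊥-elim (subst T b₀ bᵢ)
...   | suc _ with firstTrue-just (b ∘ suc) bᵢ
...     | j , found , bⱼ = suc j , cong (Maybe.map suc) found , bⱼ

representative : {x : BRel n} → IsPartition x → Fin n → Fin n
representative {x = x} Px i = proj₁ (firstTrue-just (entry x i) (IsPartition.reflexive Px i))

firstTrue-representative : {x : BRel n} (Px : IsPartition x) (i : Fin n) →
                           firstTrue (entry x i) ≡ just (representative Px i)
firstTrue-representative {x = x} Px i = proj₁ (proj₂ (firstTrue-just (entry x i) (IsPartition.reflexive Px i)))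

∼-representative : {x : BRel n} (Px : IsPartition x) (i : Fin n) → i ∼[ x ] representative Px i
∼-representative {x = x} Px i = proj₂ (proj₂ (firstTrue-just (entry x i) (IsPartition.reflexive Px i)))

∼⇔representative≡ : {x : BRel n} (Px : IsPartition x) (i j : Fin n) →
                     i ∼[ x ] j ⇔ representative Px i ≡ representative Px j
∼⇔representative≡ {x = x} Px i j = mk⇔ same-label same-block
  where
  open IsPartition Px
  same-label : i ∼[ x ] j → representative Px i ≡ representative Px j
  same-label i∼j = just-injective (begin
    just (representative Px i)  ≡⟨ firstTrue-representative Px i ⟨
    firstTrue (entry x i)       ≡⟨ firstTrue-cong same-row ⟩
    firstTrue (entry x j)       ≡⟨ firstTrue-representative Px j ⟩
    just (representative Px j)  ∎)
    where
    open ≡-Reasoning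
    same-row : entry x i ≗ entry x j
    same-row k = T-ext (transitive j i k (symmetric i j i∼j)) (transitive i j k i∼j)
  same-block : representative Px i ≡ representative Px j → i ∼[ x ] j
  same-block labels≡ = transitive i (representative Px j) j
    (subst (i ∼[ x ]_) labels≡ (∼-representative Px i))
    (symmetric j _ (∼-representative Px j))

SameImage : (Fin n → Fin n) → Pred (Fin n × Fin n) _
SameImage f (i , j) = f i ≡ f j

sameImage? : (f : Fin n → Fin n) → Decidable (SameImage f)
sameImage? f (i , j) = f i ≟ f j

kernelPairs : (Fin n → Fin n) → List (Fin n × Fin n)
kernelPairs f = filter (sameImage? f) (pairs _)

kernelPairs-cong : {f g : Fin n → Fin n} → f ≗ g → kernelPairs f ≡ kernelPairs g
kernelPairs-cong {f = f} {g} f≗g = filter-≐ (sameImage? f) (sameImage? g)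
  ((λ { {i , j} fi≡fj → trans (sym (f≗g i)) (trans fi≡fj (f≗g j)) }) ,
   (λ { {i , j} gi≡gj → trans (f≗g i) (trans gi≡gj (sym (f≗g j))) }))
  (pairs _)

relatedPairs≡kernelPairs : {x : BRel n} (Px : IsPartition x) → relatedPairs x ≡ kernelPairs (representative Px)
relatedPairs≡kernelPairs {x = x} Px = filter-≐ (related? x) (sameImage? (representative Px))
  ((λ { {i , j} → to (∼⇔representative≡ Px i j) }) , (λ { {i , j} → from (∼⇔representative≡ Px i j) }))
  (pairs _)

all-Vec? : {m k : ℕ} {P : Pred (Vec (Fin m) k) 0ℓ} → Decidable P → Dec (∀ v → P v)
all-Vec? {k = zero}  P? = map′ (λ { P[] [] → P[] }) (λ ∀P → ∀P []) (P? [])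
all-Vec? {k = suc k} P? = map′ (λ { ∀P (a ∷ v) → ∀P a v }) (λ ∀P a v → ∀P (a ∷ v))
  (all? (λ a → all-Vec? (λ v → P? (a ∷ v))))

CountDividesPairs : (n : ℕ) → List (Fin n × Fin n) → Set
CountDividesPairs n l = 0 <ℕ length l → length l ∣ length (pairs n)

countDividesPairs? : (n : ℕ) (l : List (Fin n × Fin n)) → Dec (CountDividesPairs n l)
countDividesPairs? n l = 0 <? length l →-dec (length l ∣? length (pairs n))

kernelCount-divides-≤4-vec : (n : ℕ) → n ≤ 4 → (v : Vec (Fin n) n) → CountDividesPairs n (kernelPairs (lookup v))
kernelCount-divides-≤4-vec 0 _ = toWitness {a? = all-Vec? (countDividesPairs? 0 ∘ kernelPairs ∘ lookup)} _
kernelCount-divides-≤4-vec 1 _ = toWitness {a? = all-Vec? (countDividesPairs? 1 ∘ kernelPairs ∘ lookup)} _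
kernelCount-divides-≤4-vec 2 _ = toWitness {a? = all-Vec? (countDividesPairs? 2 ∘ kernelPairs ∘ lookup)} _
kernelCount-divides-≤4-vec 3 _ = toWitness {a? = all-Vec? (countDividesPairs? 3 ∘ kernelPairs ∘ lookup)} _
kernelCount-divides-≤4-vec 4 _ = toWitness {a? = all-Vec? (countDividesPairs? 4 ∘ kernelPairs ∘ lookup)} _
kernelCount-divides-≤4-vec (suc (suc (suc (suc (suc _))))) (s≤s (s≤s (s≤s (s≤s ()))))

kernelCount-divides-≤4 : n ≤ 4 → (f : Fin n → Fin n) → CountDividesPairs n (kernelPairs f)
kernelCount-divides-≤4 {n} n≤4 f = subst (CountDividesPairs n) (kernelPairs-cong (lookup∘tabulate f))
  (kernelCount-divides-≤4-vec n n≤4 (tabulate f))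

relatedPairs-count-divides-≤4 : {x : BRel n} → n ≤ 4 → IsPartition x → x ≢ bottom n →
                                length (relatedPairs x) ∣ length (pairs n)
relatedPairs-count-divides-≤4 n≤4 Px x≢bottom =
  subst (CountDividesPairs _) (sym (relatedPairs≡kernelPairs Px))
    (kernelCount-divides-≤4 n≤4 (representative Px))
    (0<length-relatedPairs Px x≢bottom)

stronglyCosetLike-≤4 : n ≤ 4 → StronglyCosetLike n
stronglyCosetLike-≤4 {n} n≤4 x Px x≢bottom =
  length (relatedPairs x) , length (pairs n) ,
  hasSize-joinIrreducibleBelow Px , hasSize-joinIrreducible n ,
  relatedPairs-count-divides-≤4 n≤4 Px x≢bottom

-- n ≥ 5

singletonZero : (m : ℕ) → BRel (suc m)
singletonZero m = isolate (top (suc m)) zero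

singletonZero-isPartition : (m : ℕ) → IsPartition (singletonZero m)
singletonZero-isPartition m = isolate-isPartition top-isPartition zero

singletonZero≢bottom : (m : ℕ) → singletonZero (suc (suc m)) ≢ bottom (suc (suc (suc m)))
singletonZero≢bottom m isolated≡bottom =
  one≢two (to (∼-bottom one two) (subst (one ∼[_] two) isolated≡bottom one∼two))
  where
  one two : Fin (suc (suc (suc m)))
  one = suc zero
  two = suc (suc zero)
  one≢two : one ≢ two
  one≢two ()
  one∼two : one ∼[ singletonZero (suc (suc m)) ] two
  one∼two = from (∼-isolate (top _) zero one two) (inj₂ ((λ ()) , (λ ()) , ∼-top one two))

length-relatedPairs-singletonZero : (m : ℕ) → length (relatedPairs (singletonZero m)) ≡ length (pairs m)
length-relatedPairs-singletonZero m = begin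
  length (filter P? (map shift (pairs m) ++ pairsFromZero m))
    ≡⟨ cong length (filter-++ P? (map shift (pairs m)) (pairsFromZero m)) ⟩
  length (filter P? (map shift (pairs m)) ++ filter P? (pairsFromZero m))
    ≡⟨ cong₂ (λ l l′ → length (l ++ l′)) (filter-all P? shifted-related) (filter-none P? fromZero-unrelated) ⟩
  length (map shift (pairs m) ++ [])
    ≡⟨ cong length (++-identityʳ (map shift (pairs m))) ⟩
  length (map shift (pairs m))
    ≡⟨ length-map shift (pairs m) ⟩
  length (pairs m)
    ∎
  where
  open ≡-Reasoning
  P? = related? (singletonZero m)
  shifted-related : All (Related (singletonZero m)) (map shift (pairs m))
  shifted-related = All.map⁺ (All.universal
    (λ { (i , j) → from (∼-isolate (top _) zero (suc i) (suc j)) (inj₂ ((λ ()) , (λ ()) , ∼-top (suc i) (suc j))) })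
    (pairs m))
  fromZero-unrelated : All (¬_ ∘ Related (singletonZero m)) (pairsFromZero m)
  fromZero-unrelated = All.tabulate⁺ λ j zero∼j → zero-isolated (to (∼-isolate (top _) zero zero (suc j)) zero∼j)
    where
    zero-isolated : ∀ {j} → ¬ IsolateRel (top (suc m)) zero zero (suc j)
    zero-isolated (inj₁ ())
    zero-isolated (inj₂ (0≢0 , _)) = 0≢0 refl

<-length-pairs : (k : ℕ) → 4 + k <ℕ length (pairs (4 + k))
<-length-pairs zero    = s≤s (s≤s (s≤s (s≤s (s≤s z≤n))))
<-length-pairs (suc k) =
  subst (5 + k <ℕ_) (sym (trans (length-pairs (4 + k)) (+-comm (length (pairs (4 + k))) (4 + k))))
    (+-mono-≤ (s≤s z≤n) (<-length-pairs k))

¬stronglyCosetLike-5+ : (k : ℕ) → ¬ StronglyCosetLike (5 + k)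
¬stronglyCosetLike-5+ k scl
  with scl (singletonZero (4 + k)) (singletonZero-isPartition (4 + k)) (singletonZero≢bottom (2 + k))
... | a , b , a-size , b-size , a∣b = <⇒≱ (<-length-pairs k) (∣⇒≤ pairs∣m)
  where
  m = 4 + k
  a≡ : a ≡ length (pairs m)
  a≡ = trans (hasSize-unique a-size (hasSize-joinIrreducibleBelow (singletonZero-isPartition m)))
             (length-relatedPairs-singletonZero m)
  b≡ : b ≡ length (pairs m) + m
  b≡ = trans (hasSize-unique b-size (hasSize-joinIrreducible (suc m))) (length-pairs m)
  pairs∣m : length (pairs m) ∣ m
  pairs∣m = ∣m+n∣m⇒∣n (subst₂ _∣_ a≡ b≡ a∣b) ∣-refl

¬stronglyCosetLike-≥5 : 5 ≤ n → ¬ StronglyCosetLike n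
¬stronglyCosetLike-≥5 5≤n with m≤n⇒∃[o]m+o≡n 5≤n
... | k , refl = ¬stronglyCosetLike-5+ k

mainTheorem4 : (n : ℕ) → 2 ≤ n → (StronglyCosetLike n ⇔ n ≤ 4)
mainTheorem4 n _ = mk⇔
  (λ scl → ≮⇒≥ (λ 4<n → ¬stronglyCosetLike-≥5 4<n scl))
  stronglyCosetLike-≤4
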